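{- Let $n\ge 2$ and let $T$ be a rooted tree on the vertex set $\{1,\dots,n\}$ with (normal) slither code $(s_1,\dots,s_{n-1})$. Let $\beta$ be the smallest number such that the prefix $(s_1,\dots,s_\beta)$ contains at least $n-1-\beta$ distinct numbers. Then the matching number of $T$ equals the number of distinct numbers occurring in $(s_1,\dots,s_\beta)$.
   Context: Edges of $T$ are directed away from the root. A vertex is a $P$-position iff none of its children is a $P$-position (leaves are $P$-positions); otherwise it is an $N$-position. Slither code: start with $n-1$ empty slots; repeat $n-1$ times: among non-root vertices of the current tree with no remaining children, remove the one with smallest label and put its label into the leftmost empty slot if it is a $P$-position of the original tree $T$, otherwise into the rightmost empty slot. This gives $(a_1,\dots,a_{n-1})$; then $s_i$ is the parent of $a_i$ in $T$. The matching number is the maximum size of a set of edges no two of which share a vertex. -}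

module Defs where

open import Data.Nat using (ℕ; zero; suc; _≤_; _∸_; _<_)
open import Data.Fin using (Fin)
open import Data.Fin.Properties using (_≟_)
open import Data.Bool using (Bool; true; false; not; _∧_; if_then_else_)
open import Data.List using (List; []; _∷_; _++_; filter; map; length; take; allFin; deduplicate)
open import Data.Bool.ListAction using (all; any)
open import Data.List.Relation.Unary.All using (All)
open import Data.List.Relation.Unary.AllPairs using (AllPairs)
open import Data.Product using (_×_; _,_; ∃-syntax; Σ-syntax)
open import Relation.Binary.PropositionalEquality using (_≡_; _≢_)
open import Relation.Nullary using (does; ¬_)
open import Relation.Nullary.Decidable using (¬?)

iter : {A : Set} → (A → A) → ℕ → A → A
iter f zero    x = x
iter f (suc k) x = f (iter f k x)

-- A rooted tree on the vertex set Fin n (vertex i stands for label toℕ i + 1),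
-- given by its root and the parent map (the root is its own "parent" by convention);
-- every vertex reaches the root by following parents.
record RootedTree (n : ℕ) : Set where
  field
    root        : Fin n
    parent      : Fin n → Fin n
    parent-root : parent root ≡ root
    reaches     : ∀ v → ∃[ k ] iter parent k v ≡ root

module _ {n : ℕ} (T : RootedTree n) where
  open RootedTree T

  eqᵇ : Fin n → Fin n → Bool
  eqᵇ u v = does (u ≟ v)

  isChildᵇ : Fin n → Fin n → Bool
  isChildᵇ u v = not (eqᵇ u root) ∧ eqᵇ (parent u) v

  children : Fin n → List (Fin n)
  children v = filter (λ u → Data.Bool.T? (isChildᵇ u v)) (allFin n)

  -- P-position test with fuel: a vertex is P iff no child is P (leaves are P).
  -- The fuel n exceeds the height of T, so isPᶠ n computes the P-positions exactly.
  isPᶠ : ℕ → Fin n → Bool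
  isPᶠ zero    v = true
  isPᶠ (suc f) v = all (λ u → not (isPᶠ f u)) (children v)

  isP : Fin n → Bool
  isP = isPᶠ n

  candidates : List (Fin n) → List (Fin n)
  candidates rem = filter (λ v → Data.Bool.T?
      (any (λ w → eqᵇ w v) rem ∧ not (eqᵇ v root) ∧ not (any (λ u → isChildᵇ u v) rem)))
    (allFin n)

  removalOrder : ℕ → List (Fin n) → List (Fin n)
  removalOrder zero    rem = []
  removalOrder (suc k) rem with candidates rem
  ... | []    = []
  ... | v ∷ _ = v ∷ removalOrder k (filter (λ u → ¬? (u ≟ v)) rem)

  -- slot filling: the filled slots always form a left block and a right block;
  -- leftmost empty slot = end of the left block, rightmost empty slot = start of the right block.
  fillSlots : List (Fin n) → List (Fin n) → List (Fin n) → List (Fin n)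
  fillSlots left right []       = left ++ right
  fillSlots left right (v ∷ vs) =
    if isP v then fillSlots (left ++ (v ∷ [])) right vs
             else fillSlots left (v ∷ right) vs

  slitherSeq : List (Fin n)
  slitherSeq = fillSlots [] [] (removalOrder (n ∸ 1) (allFin n))

  slitherCode : List (Fin n)
  slitherCode = map parent slitherSeq

  IsEdge : Fin n × Fin n → Set
  IsEdge (p , c) = c ≢ root × parent c ≡ p

  Disjoint : Fin n × Fin n → Fin n × Fin n → Set
  Disjoint (a , b) (c , d) = a ≢ c × a ≢ d × b ≢ c × b ≢ d

  IsMatching : List (Fin n × Fin n) → Set
  IsMatching M = All IsEdge M × AllPairs Disjoint M

  IsMatchingNumber : ℕ → Set
  IsMatchingNumber m =
    (∃[ M ] (IsMatching M × length M ≡ m)) × (∀ M → IsMatching M → length M ≤ m)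

numDistinct : {n : ℕ} → List (Fin n) → ℕ
numDistinct xs = length (deduplicate _≟_ xs)

BetaCond : {n : ℕ} → List (Fin n) → ℕ → Set
BetaCond {n} s β = n ∸ 1 ∸ β ≤ numDistinct (take β s)

-- The P-positions form an independent set and every N-position has a P-position child,
-- so matching each N-position with such a child is a maximum matching: every edge has an
-- N-position endpoint, and disjoint edges have distinct ones.  The matching number is thus
-- the number m of N-positions.
-- In the slither code the left block of slots receives the non-root P-positions, so the
-- first p entries of the code are their parents, which are exactly the N-positions.
-- Counting with p ≤ #P ≤ p + 1 and #P + m = n shows that the prefix of length p satisfies
-- the condition defining β, so β ≤ p; a prefix of length β < p has at most m distinct
-- entries but, satisfying the condition, at least n − 1 − β ≥ m.  Either way the first β
-- entries contain exactly m distinct numbers.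

module Submission where

open import Defs
open import Level using (0ℓ)
open import Data.Bool using (Bool; true; false; not; _∧_; if_then_else_; T; T?)
open import Data.Bool.ListAction using (all; any; and)
open import Data.Bool.Properties using (T-∧; T-≡)
open import Data.Fin using (Fin; toℕ)
open import Data.Fin.Properties using (_≟_; pigeonhole; toℕ<n)
open import Data.List using (List; []; _∷_; _++_; filter; map; length; take; allFin)
open import Data.List.Properties
  using (filter-notAll; length-map; length-tabulate; take-all; map-cong; map-cong-local; map-++; ++-assoc)
open import Data.List.Extrema.Nat using (argmax; argmax-all; f[⊥]≤f[argmax]; f[xs]≤f[argmax])
open import Data.List.Membership.Propositional using (_∈_; find)
open import Data.List.Membership.Propositional.Properties
  using (∈-allFin; ∈-filter⁺; ∈-filter⁻; ∈-map⁺; ∈-map⁻; ∈-deduplicate⁺; ∈-deduplicate⁻)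
open import Data.List.Relation.Binary.Subset.Propositional using (_⊆_)
open import Data.List.Relation.Unary.All as All using (All; []; _∷_)
import Data.List.Relation.Unary.All.Properties as All
open import Data.List.Relation.Unary.AllPairs as AllPairs using (AllPairs; []; _∷_)
import Data.List.Relation.Unary.AllPairs.Properties as AllPairs
open import Data.List.Relation.Unary.Any as Any using (here; there)
open import Data.List.Relation.Unary.Any.Properties using (any⁺; any⁻)
open import Data.List.Relation.Unary.Unique.Propositional using (Unique)
import Data.List.Relation.Unary.Unique.Propositional.Properties as Unique
open import Data.List.Relation.Unary.Unique.DecPropositional.Properties using (deduplicate-!)
open import Data.Nat using (ℕ; zero; suc; _+_; _∸_; _≤_; _<_; z≤n; s≤s)
open import Data.Nat.Properties
  using (≤-refl; ≤-reflexive; ≤-trans; ≤-antisym; ≤-pred; ≮⇒≥; ≰⇒>; <⇒≱; m≤n⇒m<n∨m≡n; n<1+n;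
         n≤0⇒n≡0; +-comm; +-suc; +-monoˡ-≤; +-monoʳ-<; m≤n+m; m∸n+n≡m; m+n∸m≡n; m≤n+o⇒m∸n≤o;
         ∸-monoʳ-≤; module ≤-Reasoning)
open import Data.Product using (_×_; _,_; proj₁; proj₂; ∃-syntax)
open import Data.Sum using (inj₁; inj₂)
open import Function using (_∘_; _⇔_; mk⇔; Equivalence)
open import Relation.Binary.Core using (Rel)
open import Relation.Binary.Definitions using (DecidableEquality)
open import Relation.Binary.PropositionalEquality
  using (_≡_; _≢_; refl; sym; trans; cong; subst; module ≡-Reasoning)
open import Relation.Nullary using (¬_; does; yes; no; ¬?; contradiction)
open import Relation.Nullary.Decidable using (decidable-stable)
open import Relation.Unary using (Pred; Decidable)
open import Relation.Unary.Properties using (∁?)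

least-witness : {P : ℕ → Set} → Decidable P → ∀ {k} → P k →
                ∃[ d ] P d × (∀ {j} → j < d → ¬ P j)
least-witness P? {zero} pk = zero , pk , λ ()
least-witness P? {suc k} pk with P? zero
... | yes p0 = zero , p0 , λ ()
... | no ¬p0 with least-witness (P? ∘ suc) pk
...   | d , pd , below = suc d , pd , λ { {zero} _ → ¬p0 ; {suc j} (s≤s j<d) → below j<d }

iter-+ : {A : Set} (f : A → A) (i j : ℕ) (x : A) → iter f (i + j) x ≡ iter f i (iter f j x)
iter-+ f zero    j x = refl
iter-+ f (suc i) j x = cong f (iter-+ f i j x)

iter-suc : {A : Set} (f : A → A) (i : ℕ) (x : A) → iter f (suc i) x ≡ iter f i (f x)
iter-suc f zero    x = refl
iter-suc f (suc i) x = cong f (iter-suc f i x)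

T-not⇔¬T : ∀ {b} → T (not b) ⇔ (¬ T b)
T-not⇔¬T {true}  = mk⇔ (λ ()) (λ ¬t → ¬t _)
T-not⇔¬T {false} = mk⇔ (λ _ ()) (λ _ → _)

module _ {A : Set} (_≟ᴬ_ : DecidableEquality A) where

  length-filter-≢< : ∀ {x} xs → x ∈ xs → length (filter (λ y → ¬? (y ≟ᴬ x)) xs) < length xs
  length-filter-≢< xs x∈xs = filter-notAll _ xs (Any.map (λ x≡y y≢x → y≢x (sym x≡y)) x∈xs)

  Unique-⊆⇒length≤ : {xs ys : List A} → Unique xs → xs ⊆ ys → length xs ≤ length ys
  Unique-⊆⇒length≤ {[]}     _             _     = z≤n
  Unique-⊆⇒length≤ {x ∷ xs} {ys} (x∉xs ∷ uxs) xs⊆ys =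
    ≤-trans (s≤s (Unique-⊆⇒length≤ uxs xs⊆ys-x)) (length-filter-≢< ys (xs⊆ys (here refl)))
    where
    xs⊆ys-x : xs ⊆ filter (λ y → ¬? (y ≟ᴬ x)) ys
    xs⊆ys-x y∈xs = ∈-filter⁺ (λ y → ¬? (y ≟ᴬ x)) (xs⊆ys (there y∈xs))
                             (λ y≡x → All.lookup x∉xs y∈xs (sym y≡x))

module _ {A : Set} where

  take-++ˡ : ∀ k (xs ys : List A) → k ≤ length xs → take k (xs ++ ys) ≡ take k xs
  take-++ˡ zero    xs       ys _         = refl
  take-++ˡ (suc k) (x ∷ xs) ys (s≤s k≤) = cong (x ∷_) (take-++ˡ k xs ys k≤)

  ∈-take⁻ : ∀ k {xs : List A} {x} → x ∈ take k xs → x ∈ xs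
  ∈-take⁻ (suc k) {y ∷ xs} (here x≡y) = here x≡y
  ∈-take⁻ (suc k) {y ∷ xs} (there x∈) = there (∈-take⁻ k x∈)

  length-filter+length-filter-∁ : {P : Pred A 0ℓ} (P? : Decidable P) (xs : List A) →
    length (filter P? xs) + length (filter (∁? P?) xs) ≡ length xs
  length-filter+length-filter-∁ P? []       = refl
  length-filter+length-filter-∁ P? (x ∷ xs) with ih ← length-filter+length-filter-∁ P? xs | does (P? x)
  ... | true  = cong suc ih
  ... | false = trans (+-suc _ _) (cong suc ih)

  AllPairs-restrict : {P : Pred A 0ℓ} {R : Rel A 0ℓ} {xs : List A} →
    All P xs → AllPairs (λ x y → P x → P y → R x y) xs → AllPairs R xs
  AllPairs-restrict []         []         = []
  AllPairs-restrict (px ∷ pxs) (rx ∷ rxs) =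
    All.zipWith (λ (r , py) → r px py) (rx , pxs) ∷ AllPairs-restrict pxs rxs

module _ {n : ℕ} where

  numDistinct≤length : {xs ys : List (Fin n)} → xs ⊆ ys → numDistinct xs ≤ length ys
  numDistinct≤length {xs} xs⊆ys =
    Unique-⊆⇒length≤ _≟_ (deduplicate-! _≟_ xs) (xs⊆ys ∘ ∈-deduplicate⁻ _≟_ xs)

  length≤numDistinct : {xs ys : List (Fin n)} → Unique xs → xs ⊆ ys → length xs ≤ numDistinct ys
  length≤numDistinct uxs xs⊆ys = Unique-⊆⇒length≤ _≟_ uxs (∈-deduplicate⁺ _≟_ ∘ xs⊆ys)

numDistinct-take-least-β : {k m : ℕ} (L R : List (Fin (suc k))) {β : ℕ} →
  numDistinct L ≡ m → k ∸ length L ≤ m → (∀ {γ} → γ < length L → m ≤ k ∸ γ) →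
  BetaCond (L ++ R) β → (∀ γ → γ < β → ¬ BetaCond (L ++ R) γ) →
  numDistinct (take β (L ++ R)) ≡ m
numDistinct-take-least-β {k} L R {β} refl cond-L below cond-β least-β = ≤-antisym upper lower
  where
  take-L : ∀ {γ} → γ ≤ length L → take γ (L ++ R) ≡ take γ L
  take-L = take-++ˡ _ L R
  prefix-L : take (length L) (L ++ R) ≡ L
  prefix-L = trans (take-L ≤-refl) (take-all (length L) L ≤-refl)
  β≤|L| : β ≤ length L
  β≤|L| = ≮⇒≥ λ |L|<β → least-β (length L) |L|<β
    (subst (λ xs → k ∸ length L ≤ numDistinct xs) (sym prefix-L) cond-L)
  upper : numDistinct (take β (L ++ R)) ≤ numDistinct L
  upper = numDistinct≤length λ {x} x∈ →
    ∈-deduplicate⁺ _≟_ (∈-take⁻ β (subst (x ∈_) (take-L β≤|L|) x∈))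
  lower : numDistinct L ≤ numDistinct (take β (L ++ R))
  lower with m≤n⇒m<n∨m≡n β≤|L|
  ... | inj₁ β<|L| = ≤-trans (below β<|L|) cond-β
  ... | inj₂ refl  = ≤-reflexive (cong numDistinct (sym prefix-L))

module _ {n : ℕ} (marked : Fin n → Bool) where

  markedVertices : List (Fin n)
  markedVertices = filter (T? ∘ marked) (allFin n)

  unmarkedVertices : List (Fin n)
  unmarkedVertices = filter (∁? (T? ∘ marked)) (allFin n)

  ∈-markedVertices⁺ : ∀ {v} → T (marked v) → v ∈ markedVertices
  ∈-markedVertices⁺ {v} = ∈-filter⁺ (T? ∘ marked) (∈-allFin v)

  ∈-unmarkedVertices⁻ : ∀ {v} → v ∈ unmarkedVertices → ¬ T (marked v)
  ∈-unmarkedVertices⁻ v∈ = proj₂ (∈-filter⁻ (∁? (T? ∘ marked)) {xs = allFin n} v∈)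

  ∈-unmarkedVertices⁺ : ∀ {v} → ¬ T (marked v) → v ∈ unmarkedVertices
  ∈-unmarkedVertices⁺ {v} = ∈-filter⁺ (∁? (T? ∘ marked)) (∈-allFin v)

  markedVertices-Unique : Unique markedVertices
  markedVertices-Unique = Unique.filter⁺ (T? ∘ marked) (Unique.allFin⁺ n)

  unmarkedVertices-Unique : Unique unmarkedVertices
  unmarkedVertices-Unique = Unique.filter⁺ (∁? (T? ∘ marked)) (Unique.allFin⁺ n)

  length-marked+unmarked : length markedVertices + length unmarkedVertices ≡ n
  length-marked+unmarked =
    trans (length-filter+length-filter-∁ (T? ∘ marked) (allFin n)) (length-tabulate (λ i → i))

module _ {n : ℕ} (tree : RootedTree n) (marked : Fin n → Bool)
         (independent : ∀ {p c} → IsEdge tree (p , c) → T (marked p) → ¬ T (marked c))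
         (marked-child : ∀ {v} → ¬ T (marked v) → ∃[ c ] IsEdge tree (v , c) × T (marked c))
         where

  open RootedTree tree

  private
    mate : Fin n → Fin n
    mate v with T? (marked v)
    ... | yes _ = v  -- junk: mate is only used on unmarked vertices
    ... | no ¬m = proj₁ (marked-child ¬m)

    mate-spec : ∀ {v} → ¬ T (marked v) → IsEdge tree (v , mate v) × T (marked (mate v))
    mate-spec {v} ¬m with T? (marked v)
    ... | yes m  = contradiction m ¬m
    ... | no ¬m′ = proj₂ (marked-child ¬m′)

    mates-Disjoint : ∀ {v w} → v ≢ w → ¬ T (marked v) → ¬ T (marked w) →
                     Disjoint tree (v , mate v) (w , mate w)
    mates-Disjoint {v} {w} v≢w ¬mv ¬mw =
        v≢w
      , (λ v≡mw → ¬mv (subst (T ∘ marked) (sym v≡mw) (proj₂ (mate-spec ¬mw))))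
      , (λ mv≡w → ¬mw (subst (T ∘ marked) mv≡w (proj₂ (mate-spec ¬mv))))
      , (λ mv≡mw → v≢w (begin
          v                ≡⟨ proj₂ (proj₁ (mate-spec ¬mv)) ⟨
          parent (mate v)  ≡⟨ cong parent mv≡mw ⟩
          parent (mate w)  ≡⟨ proj₂ (proj₁ (mate-spec ¬mw)) ⟩
          w                ∎))
      where open ≡-Reasoning

    unmarkedEnd : Fin n × Fin n → Fin n
    unmarkedEnd (p , c) = if marked p then c else p

    unmarkedEnd-unmarked : ∀ {e} → IsEdge tree e → ¬ T (marked (unmarkedEnd e))
    unmarkedEnd-unmarked {p , c} edge with marked p in eq | independent {p} {c} edge
    ... | true  | ind = ind _
    ... | false | _   = subst T eq

    unmarkedEnd-injective : ∀ {e e′} → Disjoint tree e e′ → unmarkedEnd e ≢ unmarkedEnd e′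
    unmarkedEnd-injective {a , b} {c , d} (a≢c , a≢d , b≢c , b≢d) with marked a | marked c
    ... | true  | true  = b≢d
    ... | true  | false = b≢c
    ... | false | true  = a≢d
    ... | false | false = a≢c

  matchingNumber-unmarked : IsMatchingNumber tree (length (unmarkedVertices marked))
  matchingNumber-unmarked = (matching , is-matching , length-map _ (unmarkedVertices marked)) , bound
    where
    matching = map (λ v → v , mate v) (unmarkedVertices marked)
    is-matching : IsMatching tree matching
    is-matching =
        All.map⁺ (All.tabulate (proj₁ ∘ mate-spec ∘ ∈-unmarkedVertices⁻ marked))
      , AllPairs.map⁺ (AllPairs-restrict (All.tabulate (∈-unmarkedVertices⁻ marked))
                        (AllPairs.map mates-Disjoint (unmarkedVertices-Unique marked)))
    bound : ∀ M → IsMatching tree M → length M ≤ length (unmarkedVertices marked)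
    bound M (edges , disjoint) = subst (_≤ length (unmarkedVertices marked)) (length-map unmarkedEnd M)
      (Unique-⊆⇒length≤ _≟_ (AllPairs.map⁺ (AllPairs.map unmarkedEnd-injective disjoint)) ends⊆)
      where
      ends⊆ : map unmarkedEnd M ⊆ unmarkedVertices marked
      ends⊆ x∈ with ∈-map⁻ unmarkedEnd x∈
      ... | e , e∈M , refl = ∈-unmarkedVertices⁺ marked (unmarkedEnd-unmarked (All.lookup edges e∈M))

module _ {k : ℕ} (tree : RootedTree (suc k)) where
  open RootedTree tree

  private
    Vertex : Set
    Vertex = Fin (suc k)

  depth-witness : (v : Vertex) →
    ∃[ d ] iter parent d v ≡ root × (∀ {j} → j < d → iter parent j v ≢ root)
  depth-witness v = least-witness (λ i → iter parent i v ≟ root) {proj₁ (reaches v)} (proj₂ (reaches v))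

  depth : Vertex → ℕ
  depth v = proj₁ (depth-witness v)

  iter-depth : ∀ v → iter parent (depth v) v ≡ root
  iter-depth v = proj₁ (proj₂ (depth-witness v))

  depth-minimal : ∀ v {j} → j < depth v → iter parent j v ≢ root
  depth-minimal v = proj₂ (proj₂ (depth-witness v))

  depth-≤ : ∀ {v j} → iter parent j v ≡ root → depth v ≤ j
  depth-≤ {v} reached = ≮⇒≥ λ j<d → depth-minimal v j<d reached

  depth-root : depth root ≡ 0
  depth-root = n≤0⇒n≡0 (depth-≤ {j = 0} refl)

  depth-child : ∀ {p c} → IsEdge tree (p , c) → suc (depth p) ≤ depth c
  depth-child {c = c} (c≢root , refl) with depth c | iter-depth c
  ... | zero  | c≡root  = contradiction c≡root c≢root
  ... | suc d | reached = s≤s (depth-≤ (trans (sym (iter-suc parent d c)) reached))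

  iter-injective-below-depth : ∀ {v i j} → i < j → j ≤ depth v → iter parent i v ≢ iter parent j v
  iter-injective-below-depth {v} {i} {j} i<j j≤d same = depth-minimal v shortcut<d reached
    where
    t = depth v ∸ j
    t+j≡d : t + j ≡ depth v
    t+j≡d = m∸n+n≡m j≤d
    shortcut<d : t + i < depth v
    shortcut<d = subst (t + i <_) t+j≡d (+-monoʳ-< t i<j)
    reached : iter parent (t + i) v ≡ root
    reached = begin
      iter parent (t + i) v           ≡⟨ iter-+ parent t i v ⟩
      iter parent t (iter parent i v) ≡⟨ cong (iter parent t) same ⟩
      iter parent t (iter parent j v) ≡⟨ iter-+ parent t j v ⟨
      iter parent (t + j) v           ≡⟨ cong (λ d → iter parent d v) t+j≡d ⟩
      iter parent (depth v) v         ≡⟨ iter-depth v ⟩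
      root                            ∎
      where open ≡-Reasoning

  depth<1+k : ∀ v → depth v < suc k
  depth<1+k v = ≰⇒> λ n≤d →
    let i , j , i<j , same = pigeonhole (n<1+n (suc k)) (λ i → iter parent (toℕ i) v)
    in iter-injective-below-depth i<j (≤-trans (≤-pred (toℕ<n j)) n≤d) same

  T-eqᵇ : ∀ {u v} → T (eqᵇ tree u v) ⇔ u ≡ v
  T-eqᵇ {u} {v} with u ≟ v
  ... | yes u≡v = mk⇔ (λ _ → u≡v) (λ _ → _)
  ... | no  u≢v = mk⇔ (λ ()) u≢v

  T-isChildᵇ : ∀ {u v} → T (isChildᵇ tree u v) ⇔ IsEdge tree (v , u)
  T-isChildᵇ {u} {v} with u ≟ root | parent u ≟ v
  ... | yes u≡root | _          = mk⇔ (λ ()) (λ (u≢root , _) → u≢root u≡root)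
  ... | no  u≢root | yes pu≡v   = mk⇔ (λ _ → u≢root , pu≡v) (λ _ → _)
  ... | no  _      | no  pu≢v   = mk⇔ (λ ()) (λ (_ , pu≡v) → pu≢v pu≡v)

  ∈-children⇔ : ∀ {u v} → u ∈ children tree v ⇔ IsEdge tree (v , u)
  ∈-children⇔ {u} {v} = mk⇔
    (λ u∈ → Equivalence.to T-isChildᵇ (proj₂ (∈-filter⁻ child? {xs = allFin _} u∈)))
    (λ edge → ∈-filter⁺ child? (∈-allFin u) (Equivalence.from T-isChildᵇ edge))
    where
    child? : Decidable (λ w → T (isChildᵇ tree w v))
    child? w = T? (isChildᵇ tree w v)

  private
    isCandidateᵇ : List Vertex → Vertex → Bool
    isCandidateᵇ rem w = any (λ x → eqᵇ tree x w) rem ∧ not (eqᵇ tree w root)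
                         ∧ not (any (λ u → isChildᵇ tree u w) rem)

    isCandidate? : (rem : List Vertex) → Decidable (T ∘ isCandidateᵇ rem)
    isCandidate? rem w = T? (isCandidateᵇ rem w)

  ∈-candidates⁻ : ∀ {rem v} → v ∈ candidates tree rem → v ∈ rem × v ≢ root
  ∈-candidates⁻ {rem} v∈ =
    let in-rem , rest = Equivalence.to T-∧ (proj₂ (∈-filter⁻ (isCandidate? rem) {xs = allFin _} v∈))
        not-root , _  = Equivalence.to T-∧ rest
    in Any.map (λ t → sym (Equivalence.to T-eqᵇ t)) (any⁻ _ rem in-rem)
     , Equivalence.to T-not⇔¬T not-root ∘ Equivalence.from T-eqᵇ

  ∈-candidates⁺ : ∀ {rem v} → v ∈ rem → v ≢ root → (∀ {u} → u ∈ rem → ¬ IsEdge tree (v , u)) →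
                  v ∈ candidates tree rem
  ∈-candidates⁺ {rem} {v} v∈rem v≢root leaf = ∈-filter⁺ (isCandidate? rem) (∈-allFin v)
    (Equivalence.from T-∧ (in-rem , Equivalence.from T-∧ (not-root , no-child)))
    where
    in-rem : T (any (λ x → eqᵇ tree x v) rem)
    in-rem = any⁺ _ (Any.map (λ v≡x → Equivalence.from T-eqᵇ (sym v≡x)) v∈rem)
    not-root : T (not (eqᵇ tree v root))
    not-root = Equivalence.from T-not⇔¬T (v≢root ∘ Equivalence.to T-eqᵇ)
    no-child : T (not (any (λ u → isChildᵇ tree u v) rem))
    no-child = Equivalence.from T-not⇔¬T λ t →
      All.All¬⇒¬Any (All.tabulate λ u∈ → leaf u∈ ∘ Equivalence.to T-isChildᵇ) (any⁻ _ rem t)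

  deepest-∈-candidates : ∀ {rem w} → w ∈ rem → w ≢ root → argmax depth w rem ∈ candidates tree rem
  deepest-∈-candidates {rem} {w} w∈rem w≢root = ∈-candidates⁺ y∈rem y≢root leaf
    where
    y = argmax depth w rem
    y∈rem : y ∈ rem
    y∈rem = argmax-all depth w∈rem (All.tabulate (λ u∈ → u∈))
    y≢root : y ≢ root
    y≢root y≡root = <⇒≱ (≤-trans (s≤s z≤n) (depth-child (w≢root , refl)))
      (≤-trans (f[⊥]≤f[argmax] {f = depth} w rem) (≤-reflexive (trans (cong depth y≡root) depth-root)))
    leaf : ∀ {u} → u ∈ rem → ¬ IsEdge tree (y , u)
    leaf u∈rem edge = <⇒≱ (depth-child edge) (All.lookup (f[xs]≤f[argmax] {f = depth} w rem) u∈rem)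

  private
    ≢? : (v : Vertex) → Decidable (_≢ v)
    ≢? v u = ¬? (u ≟ v)

  removalOrder-⊆ : ∀ j rem {x} → x ∈ removalOrder tree j rem → x ∈ rem × x ≢ root
  removalOrder-⊆ zero    rem ()
  removalOrder-⊆ (suc j) rem x∈ with candidates tree rem in eq
  removalOrder-⊆ (suc j) rem (here refl) | v ∷ _ = ∈-candidates⁻ (subst (v ∈_) (sym eq) (here refl))
  removalOrder-⊆ (suc j) rem (there x∈) | v ∷ _ =
    let x∈rem-v , x≢root = removalOrder-⊆ j (filter (≢? v) rem) x∈
    in proj₁ (∈-filter⁻ (≢? v) x∈rem-v) , x≢root

  removalOrder-Unique : ∀ j rem → Unique (removalOrder tree j rem)
  removalOrder-Unique zero    rem = []
  removalOrder-Unique (suc j) rem with candidates tree rem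
  ... | []    = []
  ... | v ∷ _ = All.tabulate v∉rest ∷ removalOrder-Unique j (filter (≢? v) rem)
    where
    v∉rest : ∀ {x} → x ∈ removalOrder tree j (filter (≢? v) rem) → v ≢ x
    v∉rest x∈ v≡x = proj₂ (∈-filter⁻ (≢? v) {xs = rem} (proj₁ (removalOrder-⊆ j _ x∈))) (sym v≡x)

  removalOrder-complete : ∀ j rem {w} → length rem ≤ suc j → root ∈ rem → w ∈ rem → w ≢ root →
                          w ∈ removalOrder tree j rem
  removalOrder-complete zero    (x ∷ [])    _ (here refl) (here refl) w≢root = contradiction refl w≢root
  removalOrder-complete zero    (x ∷ _ ∷ _) (s≤s ()) _ _ _
  removalOrder-complete (suc j) rem {w} |rem|≤ root∈ w∈rem w≢root with candidates tree rem in eq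
  ... | [] = contradiction (subst (argmax depth w rem ∈_) eq (deepest-∈-candidates w∈rem w≢root)) λ ()
  ... | v ∷ _ with w ≟ v
  ...   | yes w≡v = here w≡v
  ...   | no  w≢v = there (removalOrder-complete j (filter (≢? v) rem)
            (≤-pred (≤-trans (length-filter-≢< _≟_ rem v∈rem) |rem|≤))
            (∈-filter⁺ (≢? v) root∈ (v≢root ∘ sym))
            (∈-filter⁺ (≢? v) w∈rem w≢v) w≢root)
    where
    v∈rem×v≢root = ∈-candidates⁻ (subst (v ∈_) (sym eq) (here refl))
    v∈rem = proj₁ v∈rem×v≢root
    v≢root = proj₂ v∈rem×v≢root

  depth-children : ∀ {v c} → c ∈ children tree v → suc (depth v) ≤ depth c
  depth-children = depth-child ∘ Equivalence.to ∈-children⇔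

  -- The subtree at v has height below n − depth v, so fuel beyond that changes nothing.
  isPᶠ-stable : ∀ f v → suc k ≤ depth v + suc f → isPᶠ tree f v ≡ isPᶠ tree (suc f) v
  isPᶠ-stable zero v bound = sym (Equivalence.to T-≡ (All.all⁻ _ (All.tabulate λ {c} c∈ →
    contradiction (≤-trans (≤-trans bound (≤-reflexive (+-comm (depth v) 1))) (depth-children c∈))
                  (<⇒≱ (depth<1+k c)))))
  isPᶠ-stable (suc f) v bound = cong and (map-cong-local (All.tabulate λ {c} c∈ →
    cong not (isPᶠ-stable f c (≤-trans bound (begin
      depth v + suc (suc f)  ≡⟨ +-suc (depth v) (suc f) ⟩
      suc (depth v) + suc f  ≤⟨ +-monoˡ-≤ (suc f) (depth-children c∈) ⟩
      depth c + suc f        ∎)))))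
    where open ≤-Reasoning

  isP-unfold : ∀ v → isP tree v ≡ all (λ u → not (isP tree u)) (children tree v)
  isP-unfold v = cong and
    (map-cong (λ u → cong not (isPᶠ-stable k u (m≤n+m (suc k) (depth u)))) (children tree v))

  P-independent : ∀ {p c} → IsEdge tree (p , c) → T (isP tree p) → ¬ T (isP tree c)
  P-independent {p} edge Pp = Equivalence.to T-not⇔¬T
    (All.lookup (All.all⁺ _ _ (subst T (isP-unfold p) Pp)) (Equivalence.from ∈-children⇔ edge))

  N⇒P-child : ∀ {v} → ¬ T (isP tree v) → ∃[ c ] IsEdge tree (v , c) × T (isP tree c)
  N⇒P-child {v} Nv =
    let c , c∈ , ¬Nc = find (All.¬All⇒Any¬ (T? ∘ not ∘ isP tree) _
                                            (Nv ∘ subst T (sym (isP-unfold v)) ∘ All.all⁻ _))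
    in c , Equivalence.to ∈-children⇔ c∈ , decidable-stable (T? _) (¬Nc ∘ Equivalence.from T-not⇔¬T)

  fillSlots-leftBlock : ∀ l r vs → ∃[ R ] fillSlots tree l r vs ≡ l ++ filter (T? ∘ isP tree) vs ++ R
  fillSlots-leftBlock l r []       = r , refl
  fillSlots-leftBlock l r (v ∷ vs) with isP tree v
  ... | true  = let R , eq = fillSlots-leftBlock (l ++ v ∷ []) r vs
                in R , trans eq (++-assoc l (v ∷ []) _)
  ... | false = fillSlots-leftBlock l (v ∷ r) vs

  leftBlock : List Vertex
  leftBlock = filter (T? ∘ isP tree) (removalOrder tree k (allFin (suc k)))

  slitherCode-≡ : ∃[ R ] slitherCode tree ≡ map parent leftBlock ++ R
  slitherCode-≡ =
    let R , eq = fillSlots-leftBlock [] [] (removalOrder tree k (allFin (suc k)))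
    in map parent R , trans (cong (map parent) eq) (map-++ parent leftBlock R)

  leftBlock-Unique : Unique leftBlock
  leftBlock-Unique = Unique.filter⁺ (T? ∘ isP tree) (removalOrder-Unique k _)

  ∈-leftBlock⇔ : ∀ {x} → x ∈ leftBlock ⇔ (x ≢ root × T (isP tree x))
  ∈-leftBlock⇔ {x} = mk⇔
    (λ x∈ → let x∈order , Px = ∈-filter⁻ (T? ∘ isP tree) {xs = removalOrder tree k _} x∈
            in proj₂ (removalOrder-⊆ k _ x∈order) , Px)
    (λ (x≢root , Px) → ∈-filter⁺ (T? ∘ isP tree)
      (removalOrder-complete k _ (≤-reflexive (length-tabulate (λ i → i)))
                                 (∈-allFin root) (∈-allFin x) x≢root)
      Px)

  ∈-parents-leftBlock⇔ : ∀ {v} → v ∈ map parent leftBlock ⇔ (¬ T (isP tree v))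
  ∈-parents-leftBlock⇔ = mk⇔ to from
    where
    to : ∀ {v} → v ∈ map parent leftBlock → ¬ T (isP tree v)
    to v∈ with ∈-map⁻ parent v∈
    ... | c , c∈ , refl = let c≢root , Pc = Equivalence.to ∈-leftBlock⇔ c∈
                          in λ Pv → P-independent (c≢root , refl) Pv Pc
    from : ∀ {v} → ¬ T (isP tree v) → v ∈ map parent leftBlock
    from Nv with N⇒P-child Nv
    ... | c , (c≢root , refl) , Pc = ∈-map⁺ parent (Equivalence.from ∈-leftBlock⇔ (c≢root , Pc))

  P-positions N-positions : List Vertex
  P-positions = markedVertices (isP tree)
  N-positions = unmarkedVertices (isP tree)

  matchingNumber-N-positions : IsMatchingNumber tree (length N-positions)
  matchingNumber-N-positions = matchingNumber-unmarked tree (isP tree) P-independent N⇒P-child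

  numDistinct-parents-leftBlock : numDistinct (map parent leftBlock) ≡ length N-positions
  numDistinct-parents-leftBlock = ≤-antisym
    (numDistinct≤length (∈-unmarkedVertices⁺ (isP tree) ∘ Equivalence.to ∈-parents-leftBlock⇔))
    (length≤numDistinct (unmarkedVertices-Unique (isP tree))
      (Equivalence.from ∈-parents-leftBlock⇔ ∘ ∈-unmarkedVertices⁻ (isP tree)))

  |leftBlock|≤#P : length leftBlock ≤ length P-positions
  |leftBlock|≤#P = Unique-⊆⇒length≤ _≟_ leftBlock-Unique
    (∈-markedVertices⁺ (isP tree) ∘ proj₂ ∘ Equivalence.to ∈-leftBlock⇔)

  #P≤1+|leftBlock| : length P-positions ≤ suc (length leftBlock)
  #P≤1+|leftBlock| = Unique-⊆⇒length≤ _≟_ (markedVertices-Unique (isP tree)) P⊆root∷leftBlock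
    where
    P⊆root∷leftBlock : P-positions ⊆ root ∷ leftBlock
    P⊆root∷leftBlock {x} x∈ with x ≟ root
    ... | yes x≡root = here x≡root
    ... | no  x≢root = there (Equivalence.from ∈-leftBlock⇔
                                (x≢root , proj₂ (∈-filter⁻ (T? ∘ isP tree) {xs = allFin _} x∈)))

  k∸|leftBlock|≤#N : k ∸ length leftBlock ≤ length N-positions
  k∸|leftBlock|≤#N = m≤n+o⇒m∸n≤o k (length leftBlock) (≤-pred (begin
    suc k                        ≡⟨ length-marked+unmarked (isP tree) ⟨
    #P + #N                      ≤⟨ +-monoˡ-≤ #N #P≤1+|leftBlock| ⟩
    suc (length leftBlock) + #N  ∎))
    where
    open ≤-Reasoning
    #P = length P-positions
    #N = length N-positions

  #N≤k∸γ : ∀ {γ} → γ < length leftBlock → length N-positions ≤ k ∸ γ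
  #N≤k∸γ {γ} γ<|leftBlock| = begin
    #N             ≡⟨ m+n∸m≡n #P #N ⟨
    #P + #N ∸ #P   ≡⟨ cong (_∸ #P) (length-marked+unmarked (isP tree)) ⟩
    suc k ∸ #P     ≤⟨ ∸-monoʳ-≤ (suc k) (≤-trans γ<|leftBlock| |leftBlock|≤#P) ⟩
    suc k ∸ suc γ  ∎
    where
    open ≤-Reasoning
    #P = length P-positions
    #N = length N-positions

  numDistinct-take-least-β≡#N : ∀ {β} → BetaCond (slitherCode tree) β →
    (∀ γ → γ < β → ¬ BetaCond (slitherCode tree) γ) →
    numDistinct (take β (slitherCode tree)) ≡ length N-positions
  numDistinct-take-least-β≡#N cond-β least-β with slitherCode tree | slitherCode-≡
  ... | _ | R , refl = numDistinct-take-least-β (map parent leftBlock) R numDistinct-parents-leftBlock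
    (subst (λ p → k ∸ p ≤ length N-positions) (sym (length-map parent leftBlock)) k∸|leftBlock|≤#N)
    (λ {γ} → #N≤k∸γ ∘ subst (γ <_) (length-map parent leftBlock)) cond-β least-β

proposition11 : (n : ℕ) → 2 ≤ n → (T : RootedTree n) → (β : ℕ) → β ≤ n ∸ 1
    → BetaCond (slitherCode T) β
    → (∀ γ → γ < β → ¬ BetaCond (slitherCode T) γ)
    → IsMatchingNumber T (numDistinct (take β (slitherCode T)))
proposition11 zero    ()
proposition11 (suc k) _ tree β _ cond-β least-β =
  subst (IsMatchingNumber tree) (sym (numDistinct-take-least-β≡#N tree cond-β least-β))
    (matchingNumber-N-positions tree)
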